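{- Let $k\geq1$ and let $y,a,n_1,\ldots,n_k,n,m$ be non-negative integers satisfying \[ y=F_{n_1}+\dots+F_{n_k}\qquad\text{and}\qquad y^a=F_n+F_m, \] with $y\geq 2$, $a\geq 2$, $n_k\geq 2$, $n_i\geq n_{i+1}+2$ for $i=1,\ldots,k-1$, and $n-2\geq m\geq 2$. Then $n_1<n$ and $a<n$.
   Context: $(F_j)_{j\geq 0}$ is the Fibonacci sequence, $F_0=0$, $F_1=1$, $F_{j+2}=F_{j+1}+F_j$. -}

module Defs where

open import Data.Nat using (ℕ; zero; suc; _+_)
open import Data.Vec using (Vec; foldr)

F : ℕ → ℕ
F zero = zero
F (suc zero) = suc zero
F (suc (suc j)) = F (suc j) + F j

fibSum : ∀ {k} → Vec ℕ k → ℕ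
fibSum = foldr _ (λ x acc → F x + acc) 0

{-# OPTIONS --safe #-}
-- Since 2 ≤ m ≤ n − 2, F m < F (n − 1), so F n < y ^ a < F (n + 1).
-- If n ≤ n₁ then F (n + 1) ≤ 2 F n ≤ 2 y ≤ y ^ a; if n ≤ a then
-- F (n + 1) ≤ 2 ^ n ≤ 2 ^ a ≤ y ^ a. Both contradict the upper bound; of the
-- Zeckendorf conditions on the nᵢ only F n₁ ≤ y is needed.
module Submission where

open import Defs
open import Data.Nat using (ℕ; zero; suc; _+_; _*_; _^_; _≤_; _<_; _≤′_; ≤′-refl; ≤′-step; z≤n; s≤s)
open import Data.Nat.Properties
open import Data.Fin using (Fin; inject₁; fromℕ)
open import Data.Vec using (Vec; lookup; _∷_)
open import Relation.Binary.PropositionalEquality using (_≡_; refl; sym; cong; subst)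
open import Data.Product using (_×_; _,_)

F-suc-≥ : ∀ j → F j ≤ F (suc j)
F-suc-≥ zero = z≤n
F-suc-≥ (suc j) = m≤m+n (F (suc j)) (F j)

F-mono-≤′ : ∀ {i j} → i ≤′ j → F i ≤ F j
F-mono-≤′ ≤′-refl = ≤-refl
F-mono-≤′ (≤′-step {j} i≤′j) = ≤-trans (F-mono-≤′ i≤′j) (F-suc-≥ j)

F-mono-≤ : ∀ {i j} → i ≤ j → F i ≤ F j
F-mono-≤ i≤j = F-mono-≤′ (≤⇒≤′ i≤j)

F-suc-pos : ∀ j → 0 < F (suc j)
F-suc-pos zero = s≤s z≤n
F-suc-pos (suc j) = ≤-trans (F-suc-pos j) (m≤m+n _ _)

F-suc-suc-<-suc : ∀ j → F (suc (suc j)) < F (suc (suc (suc j)))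
F-suc-suc-<-suc j = m<m+n (F (suc (suc j))) (F-suc-pos j)

F-suc-≤-double : ∀ {n} → 0 < n → F (suc n) ≤ 2 * F n
F-suc-≤-double {suc j} _ = +-monoʳ-≤ (F (suc j)) (≤-trans (F-suc-≥ j) (m≤m+n (F (suc j)) 0))

F-suc-≤-2^ : ∀ j → F (suc j) ≤ 2 ^ j
F-suc-≤-2^ zero = s≤s z≤n
F-suc-≤-2^ (suc j) = begin
  F (suc j) + F j   ≤⟨ +-mono-≤ (F-suc-≤-2^ j) (≤-trans (F-suc-≥ j) (F-suc-≤-2^ j)) ⟩
  2 ^ j + 2 ^ j     ≡⟨ cong (2 ^ j +_) (sym (+-identityʳ (2 ^ j))) ⟩
  2 * 2 ^ j         ∎
  where open ≤-Reasoning

F-head-≤-fibSum : ∀ {k} h (xs : Vec ℕ k) → F h ≤ fibSum (h ∷ xs)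
F-head-≤-fibSum h xs = m≤m+n (F h) (fibSum xs)

F-<-F-suc : ∀ {m n} → 2 ≤ n → m ≤ n → F m < F (suc n)
F-<-F-suc {n = suc (suc j)} (s≤s (s≤s z≤n)) m≤n = ≤-<-trans (F-mono-≤ m≤n) (F-suc-suc-<-suc j)

F+F-<-F-suc : ∀ {n m} → 2 ≤ m → 2 + m ≤ n → F n + F m < F (suc n)
F+F-<-F-suc {suc (suc n)} 2≤m (s≤s (s≤s m≤n)) =
  +-monoʳ-< (F (suc (suc n))) (F-<-F-suc (≤-trans 2≤m m≤n) m≤n)

double-≤-^ : ∀ {y} a → 2 ≤ y → 2 ≤ a → 2 * y ≤ y ^ a
double-≤-^ {y@(suc _)} a 2≤y 2≤a = begin
  2 * y       ≤⟨ *-monoˡ-≤ y 2≤y ⟩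
  y * y       ≡⟨ sym (cong (y *_) (*-identityʳ y)) ⟩
  y ^ 2       ≤⟨ ^-monoʳ-≤ y 2≤a ⟩
  y ^ a       ∎
  where open ≤-Reasoning

lemma2p4 : (k : ℕ) (ns : Vec ℕ (suc k)) (y a n m : ℕ) →
    y ≡ fibSum ns →
    y ^ a ≡ F n + F m →
    2 ≤ y →
    2 ≤ a →
    2 ≤ lookup ns (fromℕ k) →
    (∀ (i : Fin k) → 2 + lookup ns (Fin.suc i) ≤ lookup ns (inject₁ i)) →
    2 + m ≤ n →
    2 ≤ m →
    lookup ns Fin.zero < n × a < n
lemma2p4 k (h ∷ xs) y a n m refl ea 2≤y 2≤a _ _ 2+m≤n 2≤m =
  ≰⇒> (λ n≤h → <⇒≱ y^a<F[1+n] (head-bound n≤h)) ,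
  ≰⇒> (λ n≤a → <⇒≱ y^a<F[1+n] (exponent-bound n≤a))
  where
  open ≤-Reasoning
  y^a<F[1+n] : y ^ a < F (suc n)
  y^a<F[1+n] = subst (_< F (suc n)) (sym ea) (F+F-<-F-suc 2≤m 2+m≤n)

  head-bound : n ≤ h → F (suc n) ≤ y ^ a
  head-bound n≤h = begin
    F (suc n)   ≤⟨ F-suc-≤-double (≤-trans (s≤s z≤n) 2+m≤n) ⟩
    2 * F n     ≤⟨ *-monoʳ-≤ 2 (≤-trans (F-mono-≤ n≤h) (F-head-≤-fibSum h xs)) ⟩
    2 * y       ≤⟨ double-≤-^ a 2≤y 2≤a ⟩
    y ^ a       ∎

  exponent-bound : n ≤ a → F (suc n) ≤ y ^ a
  exponent-bound n≤a = begin
    F (suc n)   ≤⟨ F-suc-≤-2^ n ⟩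
    2 ^ n       ≤⟨ ^-monoʳ-≤ 2 n≤a ⟩
    2 ^ a       ≤⟨ ^-monoˡ-≤ a 2≤y ⟩
    y ^ a       ∎
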